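{- Let $G\in\mathfrak{T}_a$ and let $\alpha$ be an arc weight of $G$. Then $G(\alpha)_\nu\in\mathfrak{T}_a$ for all $\nu\in\mathbb{N}_0$. If $G$ is a poset, then $G'(\alpha)_\nu$ is a poset as well.
   Context: A digraph $G=(V(G),A(G))$ has finite nonempty vertex set and arc set $A(G)\subseteq V(G)\times V(G)$; $vw$ denotes $(v,w)$; $G^*$ is $G$ with loops removed. $\mathfrak{T}_a$: digraphs $G$ with $G^*$ acyclic (no closed directed walk). A poset is a reflexive, antisymmetric, transitive digraph. An arc weight of $G$ is a map $\alpha:A(G^*)\to\mathbb{N}_0$, with $D(\alpha)=\{vw\in A(G^*):\alpha(v,w)>0\}$. For $\nu\in\mathbb{N}_0$, $G(\alpha)_\nu$ is built as follows: take pairwise disjoint sets $X_\nu(v,w)$, $vw\in A(G^*)$, disjoint from $V(G)$, with $\#X_\nu(v,w)=\nu\cdot\alpha(v,w)$; set $V(G(\alpha)_\nu)=V(G)\cup\bigcup_{vw\in D(\alpha)}X_\nu(v,w)$ and $A(G(\alpha)_\nu)=A(G)\cup\bigcup_{vw\in D(\alpha)}\big((\{v\}\times X_\nu(v,w))\cup(X_\nu(v,w)\times\{w\})\big)$. If $G$ is a poset, $G'(\alpha)_\nu$ is the transitive hull of $G(\alpha)_\nu$ with loops added at all vertices of the sets $X_\nu(v,w)$, $vw\in D(\alpha)$. -}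

module Defs where

open import Data.Nat using (ℕ; suc; _*_)
open import Data.Fin using (Fin; _≟_)
open import Data.Bool using (Bool; true; false; T; not; _∧_)
open import Data.Product using (Σ; _×_; _,_)
open import Data.Sum using (_⊎_; inj₁; inj₂)
open import Data.Empty using (⊥)
open import Data.Unit using (⊤)
open import Relation.Nullary using (¬_)
open import Relation.Nullary.Decidable using (⌊_⌋)
open import Relation.Binary.PropositionalEquality using (_≡_; _≢_)
open import Relation.Binary.Construct.Closure.Transitive using (TransClosure)

record Digraph : Set where
  field
    n   : ℕ
    adj : Fin (suc n) → Fin (suc n) → Bool

  V : Set
  V = Fin (suc n)

  Arc : V → V → Set
  Arc v w = T (adj v w)

  arc* : V → V → Bool
  arc* v w = adj v w ∧ not ⌊ v ≟ w ⌋

open Digraph public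

Loopless : {A : Set} → (A → A → Set) → A → A → Set
Loopless E x y = E x y × x ≢ y

Acyclic : {A : Set} → (A → A → Set) → Set
Acyclic {A} E = (x : A) → ¬ TransClosure (Loopless E) x x

IsPosetRel : {A : Set} → (A → A → Set) → Set
IsPosetRel {A} E =
  ((x : A) → E x x) ×
  ((x y : A) → E x y → E y x → x ≡ y) ×
  ((x y z : A) → E x y → E y z → E x z)

IsPoset : Digraph → Set
IsPoset G = IsPosetRel (Arc G)

-- An arc weight α : A(G*) → ℕ₀, represented as a total function on pairs;
-- only its values on arcs of G* are ever used.
ArcWeight : Digraph → Set
ArcWeight G = V G → V G → ℕ

-- the new vertices: X_ν(v,w) for vw ∈ A(G*), with #X_ν(v,w) = ν · α(v,w)
-- (X_ν(v,w) is empty exactly when vw ∉ D(α) or ν = 0)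
NewV : (G : Digraph) → ArcWeight G → ℕ → Set
NewV G α ν = Σ (V G) λ v → Σ (V G) λ w → T (arc* G v w) × Fin (ν * α v w)

Vα : (G : Digraph) → ArcWeight G → ℕ → Set
Vα G α ν = V G ⊎ NewV G α ν

Aα : (G : Digraph) (α : ArcWeight G) (ν : ℕ) → Vα G α ν → Vα G α ν → Set
Aα G α ν (inj₁ v) (inj₁ w) = Arc G v w
Aα G α ν (inj₁ v) (inj₂ (a , b , _ , _)) = v ≡ a
Aα G α ν (inj₂ (a , b , _ , _)) (inj₁ w) = b ≡ w
Aα G α ν (inj₂ _) (inj₂ _) = ⊥

IsNew : (G : Digraph) (α : ArcWeight G) (ν : ℕ) → Vα G α ν → Set
IsNew G α ν (inj₁ _) = ⊥
IsNew G α ν (inj₂ _) = ⊤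

A'α : (G : Digraph) (α : ArcWeight G) (ν : ℕ) → Vα G α ν → Vα G α ν → Set
A'α G α ν x y = TransClosure (Aα G α ν) x y ⊎ (x ≡ y × IsNew G α ν x)

-- Every vertex x of G(α)_ν has an entry and an exit vertex in G: a vertex of
-- X_ν(v,w) is entered from v and left towards w, an old vertex is both.
-- Following a loopless arc never moves the exit backwards in G*, and leaving an
-- old vertex moves it strictly forwards; a closed walk in G(α)_ν* can be rotated
-- to start at an old vertex, so its exits trace a closed walk in G*.
-- If G is a poset, every walk x → y in G(α)_ν gives exit x ≤ entry y in G. A
-- closed walk at x thus forces entry x = exit x, which fails for new vertices
-- since v ≠ w; so on a cycle x → y → x both ends are old and G is antisymmetric.
module Submission where

open import Defs
open import Data.Nat using (ℕ)
open import Data.Product using (Σ; _×_; _,_; proj₁; proj₂)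
open import Data.Sum using (_⊎_; inj₁; inj₂)
open import Data.Bool using (true; false; T)
open import Data.Unit using (tt)
open import Data.Empty using (⊥-elim)
open import Data.Fin using (_≟_)
open import Relation.Nullary using (yes; no)
open import Relation.Binary.PropositionalEquality using (_≡_; _≢_; refl; cong; subst)
open import Relation.Binary.Construct.Closure.Transitive
  using (TransClosure; [_]; _∷_; _∷ʳ_; _++_)

arc*-loopless : (G : Digraph) {v w : V G} → T (arc* G v w) → Loopless (Arc G) v w
arc*-loopless G {v} {w} t with adj G v w | v ≟ w
... | true  | no v≢w = tt , v≢w
... | true  | yes _  = ⊥-elim t
... | false | _      = ⊥-elim t

TransClosure-extend : {A B : Set} {R : A → A → Set} {S : B → B → Set} (f : A → B) →
  (∀ {x y} → R x y → f x ≡ f y ⊎ S (f x) (f y)) →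
  ∀ {b x y} → TransClosure S b (f x) → TransClosure R x y → TransClosure S b (f y)
TransClosure-extend {S = S} f mono {b} p [ r ] with mono r
... | inj₁ fx≡fy = subst (TransClosure S b) fx≡fy p
... | inj₂ s     = p ∷ʳ s
TransClosure-extend f mono p (r ∷ rs) =
  TransClosure-extend f mono (TransClosure-extend f mono p [ r ]) rs

module _ (G : Digraph) (α : ArcWeight G) (ν : ℕ) where

  entry exit : Vα G α ν → V G
  entry (inj₁ v)               = v
  entry (inj₂ (v , _ , _ , _)) = v
  exit (inj₁ v)                = v
  exit (inj₂ (_ , w , _ , _))  = w

  entry≢exit-new : ∀ u → entry (inj₂ u) ≢ exit (inj₂ u)
  entry≢exit-new (_ , _ , t , _) = proj₂ (arc*-loopless G t)

  Aα* : Vα G α ν → Vα G α ν → Set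
  Aα* = Loopless (Aα G α ν)

  exit-strict-from-old : ∀ {v y} → Aα* (inj₁ v) y → Loopless (Arc G) v (exit y)
  exit-strict-from-old {y = inj₁ _} (vw , v≢w) = vw , λ v≡w → v≢w (cong inj₁ v≡w)
  exit-strict-from-old {y = inj₂ (_ , _ , t , _)} (refl , _) = arc*-loopless G t

  exit-mono : ∀ {x y} → Aα* x y → exit x ≡ exit y ⊎ Loopless (Arc G) (exit x) (exit y)
  exit-mono {inj₁ _} e                   = inj₂ (exit-strict-from-old e)
  exit-mono {inj₂ _} {inj₁ _} (refl , _) = inj₁ refl
  exit-mono {inj₂ _} {inj₂ _} (() , _)

  walk-from-old : ∀ {v y} → TransClosure Aα* (inj₁ v) y →
                  TransClosure (Loopless (Arc G)) v (exit y)
  walk-from-old [ e ]      = [ exit-strict-from-old e ]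
  walk-from-old (e ∷ rest) =
    TransClosure-extend exit exit-mono [ exit-strict-from-old e ] rest

  closed-walk-at-old : ∀ {x} → TransClosure Aα* x x →
                       Σ (V G) λ v → TransClosure Aα* (inj₁ v) (inj₁ v)
  closed-walk-at-old {inj₁ v} p                           = v , p
  closed-walk-at-old {inj₂ _} [ () , _ ]
  closed-walk-at-old {inj₂ _} (_∷_ {y = inj₁ w} e rest)   = w , rest ∷ʳ e
  closed-walk-at-old {inj₂ _} (_∷_ {y = inj₂ _} (() , _) _)

  Aα-acyclic : Acyclic (Arc G) → Acyclic (Aα G α ν)
  Aα-acyclic acyclicG x p with closed-walk-at-old p
  ... | v , q = acyclicG v (walk-from-old q)

  module _ (posetG : IsPoset G) where
    private
      ≤-refl : ∀ v → Arc G v v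
      ≤-refl = proj₁ posetG
      ≤-antisym : ∀ {v w} → Arc G v w → Arc G w v → v ≡ w
      ≤-antisym {v} {w} = proj₁ (proj₂ posetG) v w
      ≤-trans : ∀ {u v w} → Arc G u v → Arc G v w → Arc G u w
      ≤-trans {u} {v} {w} = proj₂ (proj₂ posetG) u v w

    entry≤exit : ∀ x → Arc G (entry x) (exit x)
    entry≤exit (inj₁ v)               = ≤-refl v
    entry≤exit (inj₂ (_ , _ , t , _)) = proj₁ (arc*-loopless G t)

    exit≤entry : ∀ {x y} → Aα G α ν x y → Arc G (exit x) (entry y)
    exit≤entry {inj₁ _} {inj₁ _} vw   = vw
    exit≤entry {inj₁ v} {inj₂ _} refl = ≤-refl v
    exit≤entry {inj₂ _} {inj₁ w} refl = ≤-refl w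

    walk-exit≤entry : ∀ {x y} → TransClosure (Aα G α ν) x y → Arc G (exit x) (entry y)
    walk-exit≤entry {x} {y} [ a ]          = exit≤entry {x} {y} a
    walk-exit≤entry {x} (_∷_ {y = z} a as) =
      ≤-trans (exit≤entry {x} {z} a) (≤-trans (entry≤exit z) (walk-exit≤entry as))

    closed-walk-entry≡exit : ∀ {x} → TransClosure (Aα G α ν) x x → entry x ≡ exit x
    closed-walk-entry≡exit {x} p = ≤-antisym (entry≤exit x) (walk-exit≤entry p)

    A'α-antisym : ∀ x y → A'α G α ν x y → A'α G α ν y x → x ≡ y
    A'α-antisym _ _ (inj₂ (refl , _)) _             = refl
    A'α-antisym _ _ (inj₁ _) (inj₂ (refl , _))      = refl
    A'α-antisym (inj₁ _) (inj₁ _) (inj₁ p) (inj₁ q) =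
      cong inj₁ (≤-antisym (walk-exit≤entry p) (walk-exit≤entry q))
    A'α-antisym (inj₂ u) _ (inj₁ p) (inj₁ q)        =
      ⊥-elim (entry≢exit-new u (closed-walk-entry≡exit (p ++ q)))
    A'α-antisym (inj₁ _) (inj₂ u) (inj₁ p) (inj₁ q) =
      ⊥-elim (entry≢exit-new u (closed-walk-entry≡exit (q ++ p)))

    A'α-refl : ∀ x → A'α G α ν x x
    A'α-refl (inj₁ v) = inj₁ [ ≤-refl v ]
    A'α-refl (inj₂ _) = inj₂ (refl , tt)

    A'α-trans : ∀ x y z → A'α G α ν x y → A'α G α ν y z → A'α G α ν x z
    A'α-trans _ _ _ (inj₁ p) (inj₁ q)   = inj₁ (p ++ q)
    A'α-trans _ _ _ p (inj₂ (refl , _)) = p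
    A'α-trans _ _ _ (inj₂ (refl , _)) q = q

    A'α-isPoset : IsPosetRel (A'α G α ν)
    A'α-isPoset = A'α-refl , A'α-antisym , A'α-trans

lemma1 : (G : Digraph) (α : ArcWeight G) → Acyclic (Arc G) →
    ((ν : ℕ) → Acyclic (Aα G α ν)) ×
    (IsPoset G → (ν : ℕ) → IsPosetRel (A'α G α ν))
lemma1 G α acyclicG = (λ ν → Aα-acyclic G α ν acyclicG) , λ posetG ν → A'α-isPoset G α ν posetG
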